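{- Let $\mathcal{D}=(E,D)$ be the Desargues complex. Then $(E,J(T(D)))$ is a proper matroid extension of $\mathcal{D}$, and every proper matroid extension of $\mathcal{D}$ equals $(E,J(T(D)))$.
   Context: Let $K_5$ be the complete graph on $\{1,2,3,4,5\}$ and let $E$ be its set of edges (2-subsets, written $ab$). The Desargues complex is $\mathcal{D}=(E,D)$ where $D$ is the set of all edge sets of subforests of $K_5$ with at most $3$ edges (including the empty set); it is a simplicial complex of dimension $2$. A simplicial complex is a pair $(V,H)$ with $V$ finite nonempty, $H\subseteq 2^V$ containing all singletons and closed under subsets; its dimension is $\max\{|X|:X\in H\}-1$; it is a matroid if for all $I,J\in H$ with $|I|=|J|+1$ there is $i\in I\setminus J$ with $J\cup\{i\}\in H$. For a complex $(V,H)$ of dimension $d$, $T(H)=\{T\subseteq V \mid X\cup\{p\}\in H \text{ for all } X\in H \text{ with } |X|\le d,\ X\subseteq T, \text{ and all } p\in V\setminus T\}$. For a family $R\subseteq 2^V$, $J(R)$ is the set of all transversals of successive differences of chains in $R$, i.e. sets $\{x_1,\dots,x_k\}$ such that there is a chain $F_0\subset\cdots\subset F_k$ in $R$ with $x_i\in F_i\setminus F_{i-1}$. An extension of a complex $(V,H)$ of dimension $d$ is a complex $(V,H')$ with $H'\cap P_{\le d+1}(V)=H$ ($P_{\le k}(V)$ = subsets with at most $k$ elements); it is proper if $H'\ne H$. -}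

module Defs where

open import Data.Nat using (ℕ; zero; suc; _≤_; _+_)
open import Data.Fin using (Fin; zero; suc; inject₁; fromℕ)
open import Data.Fin.Subset using (Subset; _∈_; _∉_; _⊆_; _⊂_; _∪_; ⁅_⁆; ∣_∣)
open import Data.Product using (Σ; _×_; _,_; ∃; ∃-syntax)
open import Data.Sum using (_⊎_)
open import Data.Bool using (Bool; true)
open import Function using (_⇔_)
open import Function.Definitions using (Injective)
open import Relation.Binary.PropositionalEquality using (_≡_)
open import Relation.Nullary using (¬_)

Family : ℕ → Set₁
Family n = Subset n → Set

toFamily : ∀ {n} → (Subset n → Bool) → Family n
toFamily h X = h X ≡ true

SameFamily : ∀ {n} → Family n → Family n → Set
SameFamily H H' = ∀ X → H X ⇔ H' X

-- (Fin n, H) is a simplicial complex: contains all singletons, closed under subsets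
-- (the ground set is nonempty since it will always be Fin (suc _) below)
IsComplex : ∀ {n} → Family n → Set
IsComplex {n} H = (∀ (v : Fin n) → H ⁅ v ⁆) × (∀ X Y → Y ⊆ X → H X → H Y)

IsMatroid : ∀ {n} → Family n → Set
IsMatroid {n} H = ∀ I J → H I → H J → ∣ I ∣ ≡ suc ∣ J ∣ →
  ∃[ i ] (i ∈ I × i ∉ J × H (J ∪ ⁅ i ⁆))

T : ∀ {n} → ℕ → Family n → Family n
T {n} d H Tset = ∀ X → H X → ∣ X ∣ ≤ d → X ⊆ Tset →
  ∀ (p : Fin n) → p ∉ Tset → H (X ∪ ⁅ p ⁆)

-- J(R): transversals of successive differences of chains F₀ ⊂ F₁ ⊂ ⋯ ⊂ F_k in R
J : ∀ {n} → Family n → Family n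
J {n} R X = ∃[ k ] Σ (Fin (suc k) → Subset n) λ F → Σ (Fin k → Fin n) λ x →
    (∀ i → R (F i))
  × (∀ (i : Fin k) → F (inject₁ i) ⊂ F (suc i))
  × (∀ (i : Fin k) → x i ∈ F (suc i) × x i ∉ F (inject₁ i))
  × (∀ y → (y ∈ X) ⇔ (∃[ i ] (x i ≡ y)))

IsExtension : ∀ {n} → ℕ → Family n → Family n → Set
IsExtension d H H' = IsComplex H' × (∀ X → ∣ X ∣ ≤ suc d → (H' X ⇔ H X))

IsProperExtension : ∀ {n} → ℕ → Family n → Family n → Set
IsProperExtension d H H' = IsExtension d H H' × ¬ SameFamily H' H

-- vertices of K₅ are Fin 5 (= {1,…,5} shifted); edges are Fin 10 via this table
-- of the ten 2-subsets {a,b}, a < b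
ends : Fin 10 → Fin 5 × Fin 5
ends zero = (zero , suc zero)
ends (suc zero) = (zero , suc (suc zero))
ends (suc (suc zero)) = (zero , suc (suc (suc zero)))
ends (suc (suc (suc zero))) = (zero , suc (suc (suc (suc zero))))
ends (suc (suc (suc (suc zero)))) = (suc zero , suc (suc zero))
ends (suc (suc (suc (suc (suc zero))))) = (suc zero , suc (suc (suc zero)))
ends (suc (suc (suc (suc (suc (suc zero)))))) = (suc zero , suc (suc (suc (suc zero))))
ends (suc (suc (suc (suc (suc (suc (suc zero))))))) = (suc (suc zero) , suc (suc (suc zero)))
ends (suc (suc (suc (suc (suc (suc (suc (suc zero)))))))) = (suc (suc zero) , suc (suc (suc (suc zero))))
ends (suc (suc (suc (suc (suc (suc (suc (suc (suc zero))))))))) = (suc (suc (suc zero)) , suc (suc (suc (suc zero))))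

Edges : Set
Edges = Subset 10

Adj : Edges → Fin 5 → Fin 5 → Set
Adj F u v = ∃[ e ] (e ∈ F × (ends e ≡ (u , v) ⊎ ends e ≡ (v , u)))

HasCycle : Edges → Set
HasCycle F = ∃[ m ] Σ (Fin (suc (suc (suc m))) → Fin 5) λ v →
    Injective _≡_ _≡_ v
  × (∀ (i : Fin (suc (suc m))) → Adj F (v (inject₁ i)) (v (suc i)))
  × Adj F (v (fromℕ (suc (suc m)))) (v zero)

IsForest : Edges → Set
IsForest F = ¬ HasCycle F

Desargues : Family 10
Desargues F = IsForest F × ∣ F ∣ ≤ 3

{-# OPTIONS --safe #-}
-- J(T(D)) is the cycle matroid of K₅: its independent sets are the forests.
--
-- A set lies in T(D) iff it contains the third edge of every triangle with two edges in it. In K₅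
-- such a set also contains the missing edge of every cycle with all other edges in it (induct along
-- a chord), so T(D) consists of the flats of the cycle matroid. A transversal of a chain of flats
-- is a forest, since adding an edge outside a flat to a forest inside it leaves a forest;
-- conversely a forest x₁ … x_k is a transversal of the chain of closures of x₁ … x_i.
--
-- Let M be a proper matroid extension of D. Triangles are not in D, hence not in M. Nor is a 4-cycle
-- Q: the three edges joining one vertex of Q to the others are in M, and augmenting them from Q
-- closes a triangle. So the 4-sets of M are spanning trees, and M has one since it differs from D.
-- Exchanging edges along short cycles puts every spanning tree into M, and augmenting a star from a
-- 5-set of M would again close a triangle. Hence M is the cycle matroid too.
--
-- The finitely many facts about K₅ that this uses are checked exhaustively.

module Submission where

open import Defs
open import Data.Bool using (Bool; true)
import Data.Bool.Properties as Bool
open import Data.Empty using (⊥-elim)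
open import Data.Fin as Fin using (Fin; zero; suc; inject₁; fromℕ; toℕ; #_)
open import Data.Fin.Properties using (all?; any?; pigeonhole; toℕ-inject₁; <⇒≢)
open import Data.Fin.Subset
  using (Subset; _∈_; _∉_; _⊆_; _⊂_; _∪_; _-_; ⁅_⁆; ∣_∣; ⊥; inside; outside)
open import Data.Fin.Subset.Properties
  using ( _∈?_; _⊆?_; anySubset?; nonempty?; ⊆-min; ⊆-trans; drop-∷-⊆; out⊆; in⊆in
        ; p⊆p∪q; q⊆p∪q; x∈p∪q⁻; x∈⁅x⁆; x∈⁅y⁆⇒x≡y; x∈p∧x≢y⇒x∈p-y; p─q⊆p; p─⊥≡p
        ; ∪-identityʳ; ∪-identityˡ; ∣⊥∣≡0; ∣p∣≤n; ∉⊥; p⊂q⇒p⊆q; p⊆q⇒∣p∣≤∣q∣; x∈p⇒∣p-x∣<∣p∣ )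
open import Data.List using (List; []; _∷_; _++_; map)
open import Data.List.Relation.Unary.All as All using (All; []; _∷_)
import Data.List.Relation.Unary.All.Properties as All
open import Data.List.Relation.Unary.Any as Any using (Any; here; there)
import Data.List.Relation.Unary.Any.Properties as Any
open import Data.Nat as ℕ using (ℕ; zero; suc; _+_; _≤_; _<_; _≤?_; s≤s)
open import Data.Nat.Properties
  using ( ≤-reflexive; ≤-trans; ≤-antisym; ≤-pred; n≤1+n; ≰⇒>; 1+n≰n; 1+n≢n; m≤m+n; +-suc
        ; +-monoʳ-≤; suc-injective )
open import Data.Product using (_×_; ∃-syntax; _,_; proj₁; proj₂)
open import Data.Product.Properties using (≡-dec)
open import Data.Sum using (_⊎_; inj₁; inj₂; [_,_]′)
open import Data.Vec as Vec using (Vec; []; _∷_; lookup; tabulate)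
open import Data.Vec.Properties using (lookup∘tabulate; []=⇒lookup; lookup⇒[]=)
open import Function using (_∘_; _$_; id; _⇔_; mk⇔; Equivalence)
import Function.Properties.Equivalence as ⇔
open import Function.Definitions using (Injective)
open import Level using (Level)
open import Relation.Binary.PropositionalEquality
  using (_≡_; _≢_; refl; sym; trans; cong; subst; subst₂)
open import Relation.Nullary using (Dec; yes; no; does; ¬_; ¬?; contradiction)
open import Relation.Nullary.Decidable
  using (_×-dec_; _⊎-dec_; _→-dec_; map′; from-yes; dec-true; decidable-stable)
import Relation.Nullary.Decidable as Dec
open import Relation.Unary using (Pred; Decidable; _∩_)

private
  variable
    ℓ : Level
    n : ℕ
    p q r A B C X Y : Subset n
    x y a : Fin n

select : {P : Pred (Fin n) ℓ} → Decidable P → Subset n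
select P? = tabulate (does ∘ P?)

∈-select : {P : Pred (Fin n) ℓ} (P? : Decidable P) → x ∈ select P? ⇔ P x
∈-select {x = x} P? = mk⇔
  (λ x∈ → from-does (P? x) (trans (sym (lookup∘tabulate _ x)) ([]=⇒lookup x∈)))
  (λ Px → lookup⇒[]= x _ (trans (lookup∘tabulate _ x) (dec-true (P? x) Px)))
  where
  from-does : ∀ {a} {A : Set a} (A? : Dec A) → does A? ≡ true → A
  from-does (yes a) _ = a

∪-lub : p ⊆ r → q ⊆ r → p ∪ q ⊆ r
∪-lub p⊆r q⊆r x∈ = [ p⊆r , q⊆r ]′ (x∈p∪q⁻ _ _ x∈)

x∈p⇒⁅x⁆⊆p : x ∈ p → ⁅ x ⁆ ⊆ p
x∈p⇒⁅x⁆⊆p {p = p} x∈p y∈ = subst (_∈ p) (sym (x∈⁅y⁆⇒x≡y _ y∈)) x∈p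

x∈p∪⁅y⁆∧x≢y⇒x∈p : x ∈ p ∪ ⁅ y ⁆ → x ≢ y → x ∈ p
x∈p∪⁅y⁆∧x≢y⇒x∈p x∈ x≢y with x∈p∪q⁻ _ _ x∈
... | inj₁ x∈p   = x∈p
... | inj₂ x∈⁅y⁆ = contradiction (x∈⁅y⁆⇒x≡y _ x∈⁅y⁆) x≢y

x∉p-x : ∀ (p : Subset n) x → x ∉ p - x
x∉p-x (inside  ∷ p) zero    ()
x∉p-x (outside ∷ p) zero    ()
x∉p-x (_ ∷ p)       (suc x) (Vec.there x∈) = x∉p-x p x x∈

x∈p-y⇒x∈p∧x≢y : x ∈ p - y → x ∈ p × x ≢ y
x∈p-y⇒x∈p∧x≢y {p = p} {y = y} x∈ = p─q⊆p p _ x∈ , λ { refl → x∉p-x p y x∈ }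

p⊆p-x∪⁅x⁆ : ∀ x → p ⊆ (p - x) ∪ ⁅ x ⁆
p⊆p-x∪⁅x⁆ x {y} y∈p with y Fin.≟ x
... | yes refl = q⊆p∪q _ _ (x∈⁅x⁆ y)
... | no  y≢x  = p⊆p∪q _ (x∈p∧x≢y⇒x∈p-y y∈p y≢x)

∣p∪⁅x⁆∣≡1+∣p∣ : x ∉ p → ∣ p ∪ ⁅ x ⁆ ∣ ≡ suc ∣ p ∣
∣p∪⁅x⁆∣≡1+∣p∣ {x = zero}  {inside  ∷ p} x∉ = contradiction Vec.here x∉
∣p∪⁅x⁆∣≡1+∣p∣ {x = zero}  {outside ∷ p} _  = cong (suc ∘ ∣_∣) (∪-identityʳ p)
∣p∪⁅x⁆∣≡1+∣p∣ {x = suc x} {inside  ∷ p} x∉ = cong suc (∣p∪⁅x⁆∣≡1+∣p∣ (x∉ ∘ Vec.there))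
∣p∪⁅x⁆∣≡1+∣p∣ {x = suc x} {outside ∷ p} x∉ = ∣p∪⁅x⁆∣≡1+∣p∣ (x∉ ∘ Vec.there)

∣p∪⁅x⁆∣≤1+∣p∣ : ∀ (p : Subset n) x → ∣ p ∪ ⁅ x ⁆ ∣ ≤ suc ∣ p ∣
∣p∪⁅x⁆∣≤1+∣p∣ p x with x ∈? p
... | yes x∈p = ≤-trans (p⊆q⇒∣p∣≤∣q∣ (∪-lub id (x∈p⇒⁅x⁆⊆p x∈p))) (n≤1+n _)
... | no  x∉p = ≤-reflexive (∣p∪⁅x⁆∣≡1+∣p∣ x∉p)

1+∣p-x∣≡∣p∣ : x ∈ p → suc ∣ p - x ∣ ≡ ∣ p ∣
1+∣p-x∣≡∣p∣ {x = zero}  {inside  ∷ p} _              = cong (suc ∘ ∣_∣) (p─⊥≡p p)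
1+∣p-x∣≡∣p∣ {x = suc x} {inside  ∷ p} (Vec.there x∈) = cong suc (1+∣p-x∣≡∣p∣ x∈)
1+∣p-x∣≡∣p∣ {x = suc x} {outside ∷ p} (Vec.there x∈) = 1+∣p-x∣≡∣p∣ x∈

⊆-of-size : ∀ k (p : Subset n) → k ≤ ∣ p ∣ → ∃[ q ] (q ⊆ p × ∣ q ∣ ≡ k)
⊆-of-size {n} zero p _ = ⊥ , ⊆-min p , ∣⊥∣≡0 n
⊆-of-size (suc k) (outside ∷ p) k≤      =
  let q , q⊆p , ∣q∣ = ⊆-of-size (suc k) p k≤ in outside ∷ q , out⊆ q⊆p , ∣q∣
⊆-of-size (suc k) (inside  ∷ p) (s≤s k≤) =
  let q , q⊆p , ∣q∣ = ⊆-of-size k p k≤ in inside ∷ q , in⊆in q⊆p , cong suc ∣q∣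

all-subsets? : {P : Pred (Subset n) ℓ} → Decidable P → Dec (∀ X → P X)
all-subsets? P? = map′
  (λ ∄¬P X → decidable-stable (P? X) (∄¬P ∘ (X ,_)))
  (λ ∀P (X , ¬PX) → ¬PX (∀P X))
  (¬? (anySubset? (¬? ∘ P?)))

all-subsets-of? : ∀ (M : Subset n) {P : Pred (Subset n) ℓ} → Decidable P → Dec (∀ X → X ⊆ M → P X)
all-subsets-of? []            P? = map′ (λ { P[] [] _ → P[] }) (λ ∀P → ∀P [] id) (P? [])
all-subsets-of? (outside ∷ M) P? = map′
  (λ { ∀P (outside ∷ X) X⊆ → ∀P X (drop-∷-⊆ X⊆)
     ; ∀P (inside  ∷ X) X⊆ → contradiction (X⊆ Vec.here) λ () })
  (λ ∀P X (X⊆ : X ⊆ M) → ∀P (outside ∷ X) (out⊆ X⊆))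
  (all-subsets-of? M (P? ∘ (outside ∷_)))
all-subsets-of? (inside ∷ M) P? = map′
  (λ { (∀Pₒ , ∀Pᵢ) (outside ∷ X) X⊆ → ∀Pₒ X (drop-∷-⊆ X⊆)
     ; (∀Pₒ , ∀Pᵢ) (inside  ∷ X) X⊆ → ∀Pᵢ X (drop-∷-⊆ X⊆) })
  (λ ∀P → (λ X (X⊆ : X ⊆ M) → ∀P (outside ∷ X) (out⊆ X⊆))
        , (λ X (X⊆ : X ⊆ M) → ∀P (inside ∷ X) (in⊆in X⊆)))
  (all-subsets-of? M (P? ∘ (outside ∷_)) ×-dec all-subsets-of? M (P? ∘ (inside ∷_)))

all-vectors? : ∀ {m} k {P : Pred (Vec (Fin m) k) ℓ} → Decidable P → Dec (∀ t → P t)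
all-vectors? zero    P? = map′ (λ { P[] [] → P[] }) (_$ []) (P? [])
all-vectors? (suc k) P? = map′ (λ { ∀P (x ∷ t) → ∀P x t }) (λ ∀P x t → ∀P (x ∷ t))
  (all? λ x → all-vectors? k (P? ∘ (x ∷_)))

injective? : ∀ {k m} (f : Fin k → Fin m) → Dec (Injective _≡_ _≡_ f)
injective? f = map′ (λ inj {i} {j} → inj i j) (λ inj i j → inj)
  (all? λ i → all? λ j → (f i Fin.≟ f j) →-dec (i Fin.≟ j))

any-∩ : ∀ {a} {S : Set a} {P Q : Pred S ℓ} {xs} → All P xs → Any Q xs → Any (P ∩ Q) xs
any-∩ (Px ∷ _)   (here Qx)  = here (Px , Qx)
any-∩ (_  ∷ Pxs) (there Qxs) = there (any-∩ Pxs Qxs)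

-- Flats, closures and chains

DownClosed : Family n → Set
DownClosed H = ∀ X Y → Y ⊆ X → H X → H Y

complex-resp : ∀ {H H′ : Family n} → SameFamily H H′ → IsComplex H → IsComplex H′
complex-resp H≈H′ (singletons , down) =
  (λ v → Equivalence.to (H≈H′ _) (singletons v)) ,
  (λ X Y Y⊆X H′X → Equivalence.to (H≈H′ Y) (down X Y Y⊆X (Equivalence.from (H≈H′ X) H′X)))

matroid-resp : ∀ {H H′ : Family n} → SameFamily H H′ → IsMatroid H → IsMatroid H′
matroid-resp H≈H′ matroid I J H′I H′J ∣I∣≡1+∣J∣
  with matroid I J (Equivalence.from (H≈H′ I) H′I) (Equivalence.from (H≈H′ J) H′J) ∣I∣≡1+∣J∣
... | i , i∈I , i∉J , HJ∪i = i , i∈I , i∉J , Equivalence.to (H≈H′ _) HJ∪i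

IsFlat : Family n → Family n
IsFlat H F = ∀ A → H A → A ⊆ F → ∀ p → p ∉ F → H (A ∪ ⁅ p ⁆)

flat⇒T : ∀ d {H : Family n} {F} → IsFlat H F → T d (λ X → H X × ∣ X ∣ ≤ suc d) F
flat⇒T d flat A (HA , _) ∣A∣≤d A⊆F p p∉F =
  flat A HA A⊆F p p∉F , ≤-trans (∣p∪⁅x⁆∣≤1+∣p∣ A p) (s≤s ∣A∣≤d)

module _ {H : Family n} where

  extend-along-chain : ∀ {k} (F : Fin (suc k) → Subset n) (x : Fin k → Fin n) →
    (∀ i → IsFlat H (F i)) → (∀ i → F (inject₁ i) ⊆ F (suc i)) →
    (∀ i → x i ∈ F (suc i) × x i ∉ F (inject₁ i)) →
    H A → A ⊆ F zero → ∃[ U ] (H U × A ⊆ U × ∀ i → x i ∈ U)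
  extend-along-chain {A = A} {k = zero}  F x _ _ _ HA _ = A , HA , id , λ ()
  extend-along-chain {A = A} {k = suc k} F x flat mono tr HA A⊆F₀ =
    U , HU , A∪x₀⊆U ∘ p⊆p∪q _ , λ { zero → A∪x₀⊆U (q⊆p∪q A _ (x∈⁅x⁆ _)) ; (suc i) → x∈U i }
    where
    HA∪x₀ = flat zero A HA A⊆F₀ (x zero) (proj₂ (tr zero))
    rest = extend-along-chain (F ∘ suc) (x ∘ suc) (flat ∘ suc) (mono ∘ suc) (tr ∘ suc)
             HA∪x₀ (∪-lub (mono zero ∘ A⊆F₀) (x∈p⇒⁅x⁆⊆p (proj₁ (tr zero))))
    U = proj₁ rest
    HU = proj₁ (proj₂ rest)
    A∪x₀⊆U = proj₁ (proj₂ (proj₂ rest))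
    x∈U = proj₂ (proj₂ (proj₂ rest))

  transversal⇒independent : DownClosed H → H ⊥ → {R : Family n} → (∀ F → R F → IsFlat H F) →
    ∀ X → J R X → H X
  transversal⇒independent down H⊥ flats X (k , F , x , RF , strict , tr , image) =
    down U X X⊆U HU
    where
    absorbed = extend-along-chain F x (λ i → flats (F i) (RF i)) (p⊂q⇒p⊆q ∘ strict) tr H⊥ (⊆-min _)
    U = proj₁ absorbed
    HU = proj₁ (proj₂ absorbed)
    X⊆U : X ⊆ U
    X⊆U {y} y∈X with Equivalence.to (image y) y∈X
    ... | i , refl = proj₂ (proj₂ (proj₂ absorbed)) i

record ChainFrom (R : Family n) (B X : Subset n) : Set where
  field
    length  : ℕ
    sets    : Fin (suc length) → Subset n
    points  : Fin length → Fin n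
    starts  : sets zero ≡ B
    members : ∀ i → R (sets i)
    strict  : ∀ i → sets (inject₁ i) ⊂ sets (suc i)
    fresh   : ∀ i → points i ∈ sets (suc i) × points i ∉ sets (inject₁ i)
    image   : ∀ y → y ∈ X ⇔ (∃[ i ] points i ≡ y)

module _ {R : Family n} where

  ChainFrom⇒J : ChainFrom R B X → J R X
  ChainFrom⇒J c = length , sets , points , members , strict , fresh , image
    where open ChainFrom c

  chain-nil : R B → (∀ y → y ∉ X) → ChainFrom R B X
  chain-nil RB ∉X = record
    { length = 0 ; sets = λ _ → _ ; points = λ () ; starts = refl ; members = λ _ → RB
    ; strict = λ () ; fresh = λ ()
    ; image = λ y → mk⇔ (λ y∈X → contradiction y∈X (∉X y)) λ { (() , _) } }

  chain-cons : R B → B ⊆ C → a ∈ C → a ∉ B → a ∈ X → ChainFrom R C (X - a) → ChainFrom R B X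
  chain-cons {B = B} {C = C} {a = a} {X = X} RB B⊆C a∈C a∉B a∈X c = record
    { length = suc length ; sets = sets′ ; points = points′ ; starts = refl ; members = members′
    ; strict = strict′ ; fresh = fresh′ ; image = image′ }
    where
    open ChainFrom c
    sets′ : Fin (suc (suc length)) → Subset _
    sets′ zero    = B
    sets′ (suc i) = sets i
    points′ : Fin (suc length) → Fin _
    points′ zero    = a
    points′ (suc i) = points i
    members′ : ∀ i → R (sets′ i)
    members′ zero    = RB
    members′ (suc i) = members i
    a∈C′ : a ∈ sets zero
    a∈C′ = subst (a ∈_) (sym starts) a∈C
    strict′ : ∀ i → sets′ (inject₁ i) ⊂ sets′ (suc i)
    strict′ zero    = subst (B ⊆_) (sym starts) B⊆C , a , a∈C′ , a∉B
    strict′ (suc i) = strict i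
    fresh′ : ∀ i → points′ i ∈ sets′ (suc i) × points′ i ∉ sets′ (inject₁ i)
    fresh′ zero    = a∈C′ , a∉B
    fresh′ (suc i) = fresh i
    image′ : ∀ y → y ∈ X ⇔ (∃[ i ] points′ i ≡ y)
    image′ y = mk⇔ to from
      where
      to : y ∈ X → ∃[ i ] points′ i ≡ y
      to y∈X with y Fin.≟ a
      ... | yes refl = zero , refl
      ... | no  y≢a  = let i , xᵢ≡y = Equivalence.to (image y) (x∈p∧x≢y⇒x∈p-y y∈X y≢a) in suc i , xᵢ≡y
      from : ∃[ i ] points′ i ≡ y → y ∈ X
      from (zero  , refl) = a∈X
      from (suc i , xᵢ≡y) = p─q⊆p X _ (Equivalence.from (image y) (i , xᵢ≡y))

module _ {H : Family n} (down : DownClosed H) (matroid : IsMatroid H) where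

  augment : H A → H B → ∣ A ∣ < ∣ B ∣ → ∃[ e ] (e ∈ B × e ∉ A × H (A ∪ ⁅ e ⁆))
  augment {A = A} {B = B} HA HB ∣A∣<∣B∣ = e , W⊆B e∈W , e∉A , HA∪e
    where
    W-sized = ⊆-of-size (suc ∣ A ∣) B ∣A∣<∣B∣
    W⊆B = proj₁ (proj₂ W-sized)
    augmented = matroid _ A (down _ _ W⊆B HB) HA (proj₂ (proj₂ W-sized))
    e = proj₁ augmented
    e∈W = proj₁ (proj₂ augmented)
    e∉A = proj₁ (proj₂ (proj₂ augmented))
    HA∪e = proj₂ (proj₂ (proj₂ augmented))

module Closure {H : Family n} (H? : Decidable H) (down : DownClosed H) where

  closure : Subset n → Subset n
  closure A = select λ a → a ∈? A ⊎-dec ¬? (H? (A ∪ ⁅ a ⁆))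

  ∈-closure : a ∈ closure A ⇔ (a ∈ A ⊎ ¬ H (A ∪ ⁅ a ⁆))
  ∈-closure {A = A} = ∈-select λ a → a ∈? A ⊎-dec ¬? (H? (A ∪ ⁅ a ⁆))

  ⊆-closure : A ⊆ closure A
  ⊆-closure = Equivalence.from ∈-closure ∘ inj₁

  ∉-closure⁻ : a ∉ closure A → a ∉ A × H (A ∪ ⁅ a ⁆)
  ∉-closure⁻ a∉ = a∉ ∘ ⊆-closure , decidable-stable (H? _) (a∉ ∘ Equivalence.from ∈-closure ∘ inj₂)

  ∉-closure⁺ : a ∉ A → H (A ∪ ⁅ a ⁆) → a ∉ closure A
  ∉-closure⁺ a∉A HAa a∈ = [ a∉A , (λ ¬HAa → ¬HAa HAa) ]′ (Equivalence.to ∈-closure a∈)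

  closure-mono : A ⊆ B → closure A ⊆ closure B
  closure-mono {A = A} {B = B} A⊆B {a} a∈ = Equivalence.from ∈-closure
    ([ inj₁ ∘ A⊆B , (λ ¬HAa → inj₂ (¬HAa ∘ down _ _ (∪-lub (p⊆p∪q _ ∘ A⊆B) (q⊆p∪q B _)))) ]′
       (Equivalence.to ∈-closure a∈))

  closure-chain : {R : Family n} → (∀ A → H A → R (closure A)) →
    ∀ k S X → ∣ X ∣ ≤ k → H (S ∪ X) → (∀ {y} → y ∈ X → y ∉ S) → ChainFrom R (closure S) X
  closure-chain {R} R-closure k S X ∣X∣≤k HS∪X disjoint with nonempty? X
  ... | no  X-empty = chain-nil (R-closure S HS) (λ y y∈X → X-empty (y , y∈X))
    where HS = down _ _ (p⊆p∪q X) HS∪X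
  closure-chain R-closure zero S X ∣X∣≤0 HS∪X disjoint | yes (a , a∈X) =
    contradiction (≤-trans (x∈p⇒∣p-x∣<∣p∣ a∈X) ∣X∣≤0) λ ()
  closure-chain R-closure (suc k) S X ∣X∣≤k HS∪X disjoint | yes (a , a∈X) =
    chain-cons (R-closure S HS) (closure-mono (p⊆p∪q _)) (⊆-closure (q⊆p∪q S _ (x∈⁅x⁆ a)))
      (∉-closure⁺ (disjoint a∈X) HS∪a) a∈X
      (closure-chain R-closure k (S ∪ ⁅ a ⁆) (X - a) ∣X-a∣≤k HS′∪X′ disjoint′)
    where
    HS   = down _ _ (p⊆p∪q X) HS∪X
    HS∪a = down _ _ (∪-lub (p⊆p∪q X) (q⊆p∪q S X ∘ x∈p⇒⁅x⁆⊆p a∈X)) HS∪X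
    ∣X-a∣≤k = ≤-pred (≤-trans (x∈p⇒∣p-x∣<∣p∣ a∈X) ∣X∣≤k)
    HS′∪X′ = down _ _ (∪-lub (∪-lub (p⊆p∪q X) (q⊆p∪q S X ∘ x∈p⇒⁅x⁆⊆p a∈X)) (q⊆p∪q S X ∘ p─q⊆p X _)) HS∪X
    disjoint′ : ∀ {y} → y ∈ X - a → y ∉ S ∪ ⁅ a ⁆
    disjoint′ {y} y∈X-a y∈S∪a with y Fin.≟ a
    ... | yes refl = x∉p-x X a y∈X-a
    ... | no  y≢a  = disjoint (p─q⊆p X _ y∈X-a) (x∈p∪⁅y⁆∧x≢y⇒x∈p y∈S∪a y≢a)

  independent⇒transversal : {R : Family n} → (∀ A → H A → R (closure A)) → ∀ X → H X → J R X
  independent⇒transversal {R} R-closure X HX = ChainFrom⇒J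
    (closure-chain {R = R} R-closure n ⊥ X (∣p∣≤n X) (subst H (sym (∪-identityˡ X)) HX) (λ _ → ∉⊥))

  RankBound : Set
  RankBound = ∀ {A I} → H A → H I → I ⊆ closure A → ∣ I ∣ ≤ ∣ A ∣

  rank-bound⇒matroid : RankBound → IsMatroid H
  rank-bound⇒matroid bound I J HI HJ ∣I∣≡1+∣J∣
    with any? (λ i → i ∈? I ×-dec ¬? (i ∈? J) ×-dec H? (J ∪ ⁅ i ⁆))
  ... | yes found = found
  ... | no  none  = contradiction (subst (_≤ ∣ J ∣) ∣I∣≡1+∣J∣ (bound HJ HI I⊆clJ)) 1+n≰n
    where
    I⊆clJ : I ⊆ closure J
    I⊆clJ {i} i∈I with i ∈? J
    ... | yes i∈J = ⊆-closure i∈J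
    ... | no  i∉J = Equivalence.from ∈-closure (inj₂ λ HJ∪i → none (i , i∈I , i∉J , HJ∪i))

  matroid⇒rank-bound : IsMatroid H → RankBound
  matroid⇒rank-bound matroid {A} {I} HA HI I⊆clA with ∣ I ∣ ≤? ∣ A ∣
  ... | yes ∣I∣≤∣A∣ = ∣I∣≤∣A∣
  ... | no  ∣I∣≰∣A∣ with augment down matroid HA HI (≰⇒> ∣I∣≰∣A∣)
  ...   | e , e∈I , e∉A , HA∪e =
    ⊥-elim ([ e∉A , (λ ¬HA∪e → ¬HA∪e HA∪e) ]′ (Equivalence.to ∈-closure (I⊆clA e∈I)))

  -- Augment I from A ∪ ⁅ p ⁆ until p is added: elements of A keep I inside closure A, and the rank
  -- bound allows at most ∣ A ∣ of those.
  closure-flat : IsMatroid H → H A → IsFlat H (closure A)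
  closure-flat {A = A} matroid HA I HI I⊆clA p p∉clA = extend ∣ A ∣ I HI I⊆clA (m≤m+n ∣ A ∣ ∣ I ∣)
    where
    p∉A  = proj₁ (∉-closure⁻ p∉clA)
    HA∪p = proj₂ (∉-closure⁻ p∉clA)
    bound : ∀ {I} → H I → I ⊆ closure A → ∣ I ∣ ≤ ∣ A ∣
    bound = matroid⇒rank-bound matroid HA

    extend : ∀ k I → H I → I ⊆ closure A → ∣ A ∣ ≤ k + ∣ I ∣ → H (I ∪ ⁅ p ⁆)
    extend k I HI I⊆clA slack
      with augment down matroid HI HA∪p
             (subst (∣ I ∣ <_) (sym (∣p∪⁅x⁆∣≡1+∣p∣ p∉A)) (s≤s (bound HI I⊆clA)))
    ... | e , e∈A∪p , e∉I , HI∪e with e Fin.≟ p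
    ...   | yes refl = HI∪e
    ...   | no  e≢p  = continue k slack
      where
      I∪e⊆clA : I ∪ ⁅ e ⁆ ⊆ closure A
      I∪e⊆clA = ∪-lub I⊆clA (x∈p⇒⁅x⁆⊆p (⊆-closure (x∈p∪⁅y⁆∧x≢y⇒x∈p e∈A∪p e≢p)))
      ∣I∪e∣ = ∣p∪⁅x⁆∣≡1+∣p∣ e∉I
      continue : ∀ k → ∣ A ∣ ≤ k + ∣ I ∣ → H (I ∪ ⁅ p ⁆)
      continue zero    slack = contradiction
        (≤-trans (subst (_≤ ∣ A ∣) ∣I∪e∣ (bound HI∪e I∪e⊆clA)) slack) 1+n≰n
      continue (suc k) slack = down _ _ (∪-lub (p⊆p∪q _ ∘ p⊆p∪q _) (q⊆p∪q _ _))
        (extend k (I ∪ ⁅ e ⁆) HI∪e I∪e⊆clA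
          (subst (∣ A ∣ ≤_) (sym (trans (cong (k +_) ∣I∪e∣) (+-suc k ∣ I ∣))) slack))

-- Cycles and forests of K₅

Joins : Fin 10 → Fin 5 → Fin 5 → Set
Joins e u w = ends e ≡ (u , w) ⊎ ends e ≡ (w , u)

joins? : ∀ e u w → Dec (Joins e u w)
joins? e u w = ends e ≟ (u , w) ⊎-dec ends e ≟ (w , u)
  where _≟_ = ≡-dec Fin._≟_ Fin._≟_

joins-unique : ∀ e e′ u w → Joins e u w → Joins e′ u w → e ≡ e′
joins-unique = from-yes (all? λ e → all? λ e′ → all? λ u → all? λ w →
  joins? e u w →-dec joins? e′ u w →-dec e Fin.≟ e′)

joinable : ∀ u w → u ≢ w → ∃[ e ] Joins e u w
joinable = from-yes (all? λ u → all? λ w → ¬? (u Fin.≟ w) →-dec any? λ e → joins? e u w)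

joined-∈ : ∀ {e u w} → Joins e u w → Adj X u w → e ∈ X
joined-∈ {X = X} {e} {u} {w} e-joins (e′ , e′∈X , e′-joins) =
  subst (_∈ X) (joins-unique e′ e u w e′-joins e-joins) e′∈X

inject₁≢suc : ∀ {k} (i : Fin k) → inject₁ i ≢ suc i
inject₁≢suc i eq = 1+n≢n (sym (trans (sym (toℕ-inject₁ i)) (cong toℕ eq)))

module _ {m} (v : Fin (3 + m) → Fin 5) where

  Side : Pred (Fin 10) _
  Side e = (∃[ i ] Joins e (v (inject₁ i)) (v (suc i))) ⊎ Joins e (v (fromℕ (2 + m))) (v zero)

  side? : Decidable Side
  side? e = any? (λ i → joins? e (v (inject₁ i)) (v (suc i))) ⊎-dec joins? e (v (fromℕ (2 + m))) (v zero)

  sides : Edges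
  sides = select side?

  sides-⊆ : (∀ i → Adj X (v (inject₁ i)) (v (suc i))) → Adj X (v (fromℕ (2 + m))) (v zero) → sides ⊆ X
  sides-⊆ adj close e∈ =
    [ (λ (i , e-joins) → joined-∈ e-joins (adj i)) , (λ e-joins → joined-∈ e-joins close) ]′
      (Equivalence.to (∈-select side?) e∈)

  sides⇒cycle : Injective _≡_ _≡_ v → sides ⊆ X → HasCycle X
  sides⇒cycle {X = X} inj sides⊆X =
    m , v , inj , (λ i → adjacent (inject₁≢suc i ∘ inj) (inj₁ ∘ (i ,_))) , adjacent ((λ ()) ∘ inj) inj₂
    where
    adjacent : ∀ {u w} → u ≢ w → (∀ {e} → Joins e u w → Side e) → Adj X u w
    adjacent u≢w side =
      let e , e-joins = joinable _ _ u≢w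
      in e , sides⊆X (Equivalence.from (∈-select side?) (side e-joins)) , e-joins

Polygon : Set
Polygon = ∃[ m ] Vec (Fin 5) (3 + m)

edgesOf : Polygon → Edges
edgesOf (_ , t) = sides (lookup t)

triangles : List Polygon
triangles = map (0 ,_)
  ( (# 0 ∷ # 1 ∷ # 2 ∷ []) ∷ (# 0 ∷ # 1 ∷ # 3 ∷ []) ∷ (# 0 ∷ # 1 ∷ # 4 ∷ []) ∷ (# 0 ∷ # 2 ∷ # 3 ∷ [])
  ∷ (# 0 ∷ # 2 ∷ # 4 ∷ []) ∷ (# 0 ∷ # 3 ∷ # 4 ∷ []) ∷ (# 1 ∷ # 2 ∷ # 3 ∷ []) ∷ (# 1 ∷ # 2 ∷ # 4 ∷ [])
  ∷ (# 1 ∷ # 3 ∷ # 4 ∷ []) ∷ (# 2 ∷ # 3 ∷ # 4 ∷ []) ∷ [])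

quadrilaterals : List Polygon
quadrilaterals = map (1 ,_)
  ( (# 0 ∷ # 1 ∷ # 2 ∷ # 3 ∷ []) ∷ (# 0 ∷ # 1 ∷ # 3 ∷ # 2 ∷ []) ∷ (# 0 ∷ # 2 ∷ # 1 ∷ # 3 ∷ [])
  ∷ (# 0 ∷ # 1 ∷ # 2 ∷ # 4 ∷ []) ∷ (# 0 ∷ # 1 ∷ # 4 ∷ # 2 ∷ []) ∷ (# 0 ∷ # 2 ∷ # 1 ∷ # 4 ∷ [])
  ∷ (# 0 ∷ # 1 ∷ # 3 ∷ # 4 ∷ []) ∷ (# 0 ∷ # 1 ∷ # 4 ∷ # 3 ∷ []) ∷ (# 0 ∷ # 3 ∷ # 1 ∷ # 4 ∷ [])
  ∷ (# 0 ∷ # 2 ∷ # 3 ∷ # 4 ∷ []) ∷ (# 0 ∷ # 2 ∷ # 4 ∷ # 3 ∷ []) ∷ (# 0 ∷ # 3 ∷ # 2 ∷ # 4 ∷ [])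
  ∷ (# 1 ∷ # 2 ∷ # 3 ∷ # 4 ∷ []) ∷ (# 1 ∷ # 2 ∷ # 4 ∷ # 3 ∷ []) ∷ (# 1 ∷ # 3 ∷ # 2 ∷ # 4 ∷ []) ∷ [])

pentagons : List Polygon
pentagons = map (2 ,_)
  ( (# 0 ∷ # 1 ∷ # 2 ∷ # 3 ∷ # 4 ∷ []) ∷ (# 0 ∷ # 1 ∷ # 2 ∷ # 4 ∷ # 3 ∷ [])
  ∷ (# 0 ∷ # 1 ∷ # 3 ∷ # 2 ∷ # 4 ∷ []) ∷ (# 0 ∷ # 1 ∷ # 3 ∷ # 4 ∷ # 2 ∷ [])
  ∷ (# 0 ∷ # 1 ∷ # 4 ∷ # 2 ∷ # 3 ∷ []) ∷ (# 0 ∷ # 1 ∷ # 4 ∷ # 3 ∷ # 2 ∷ [])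
  ∷ (# 0 ∷ # 2 ∷ # 1 ∷ # 3 ∷ # 4 ∷ []) ∷ (# 0 ∷ # 2 ∷ # 1 ∷ # 4 ∷ # 3 ∷ [])
  ∷ (# 0 ∷ # 2 ∷ # 3 ∷ # 1 ∷ # 4 ∷ []) ∷ (# 0 ∷ # 2 ∷ # 4 ∷ # 1 ∷ # 3 ∷ [])
  ∷ (# 0 ∷ # 3 ∷ # 1 ∷ # 2 ∷ # 4 ∷ []) ∷ (# 0 ∷ # 3 ∷ # 2 ∷ # 1 ∷ # 4 ∷ []) ∷ [])

polygons : List Polygon
polygons = triangles ++ quadrilaterals ++ pentagons

triangleEdges polygonEdges : List Edges
triangleEdges = map edgesOf triangles
polygonEdges  = map edgesOf polygons

ContainsPolygon ContainsTriangle : Edges → Set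
ContainsPolygon  X = Any (λ P → edgesOf P ⊆ X) polygons
ContainsTriangle X = Any (λ P → edgesOf P ⊆ X) triangles

any-edgesOf⇔ : ∀ Ps {Es} → map edgesOf Ps ≡ Es → Any (_⊆ X) Es ⇔ Any (λ P → edgesOf P ⊆ X) Ps
any-edgesOf⇔ {X = X} Ps refl =
  mk⇔ (Any.map⁻ {f = edgesOf} {P = _⊆ X} {xs = Ps}) (Any.map⁺ {f = edgesOf} {P = _⊆ X} {xs = Ps})

-- The modules holding the exhaustive checks take the polygon edge sets as parameters, so that an
-- exhaustive check computes them once instead of once for every edge set it tests.
module PolygonSearch (Ts Ps : List Edges) (Ts≡ : triangleEdges ≡ Ts) (Ps≡ : polygonEdges ≡ Ps) where

  containsTriangle? : Decidable ContainsTriangle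
  containsTriangle? X = Dec.map (any-edgesOf⇔ triangles Ts≡) (Any.any? (_⊆? X) Ts)

  containsPolygon? : Decidable ContainsPolygon
  containsPolygon? X = Dec.map (any-edgesOf⇔ polygons Ps≡) (Any.any? (_⊆? X) Ps)

  ClosedWalksCovered : ℕ → Set
  ClosedWalksCovered m =
    ∀ (t : Vec (Fin 5) (3 + m)) → Injective _≡_ _≡_ (lookup t) → ContainsPolygon (sides (lookup t))

  closedWalksCovered? : ∀ m → Dec (ClosedWalksCovered m)
  closedWalksCovered? m =
    all-vectors? (3 + m) λ t → injective? (lookup t) →-dec containsPolygon? (sides (lookup t))

open PolygonSearch triangleEdges polygonEdges refl refl using (ClosedWalksCovered; closedWalksCovered?)

polygons-injective : All (λ P → Injective _≡_ _≡_ (lookup (proj₂ P))) polygons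
polygons-injective = from-yes (All.all? (λ P → injective? (lookup (proj₂ P))) polygons)

polygon⇒cycle : ContainsPolygon X → HasCycle X
polygon⇒cycle P⊆X = sides⇒cycle (lookup (proj₂ (Any.lookup P⊆X)))
  (proj₁ (All.lookupAny polygons-injective P⊆X)) (proj₂ (All.lookupAny polygons-injective P⊆X))

polygons-complete : ∀ m → m ≤ 2 → ClosedWalksCovered m
polygons-complete 0 _ = from-yes (closedWalksCovered? 0)
polygons-complete 1 _ = from-yes (closedWalksCovered? 1)
polygons-complete 2 _ = from-yes (closedWalksCovered? 2)
polygons-complete (suc (suc (suc _))) (s≤s (s≤s ()))

cycle⇒polygon : HasCycle X → ContainsPolygon X
cycle⇒polygon {X = X} (m , v , inj , adj , close) with m ≤? 2
... | no m≰2 =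
  let i , j , i<j , vi≡vj = pigeonhole (+-monoʳ-≤ 3 (≰⇒> m≰2)) v in contradiction (inj vi≡vj) (<⇒≢ i<j)
... | yes m≤2 = Any.map (λ {P} → shrink {P}) (polygons-complete m m≤2 t inj′)
  where
  t = tabulate v
  v≗ : ∀ i → lookup t i ≡ v i
  v≗ = lookup∘tabulate v
  inj′ : Injective _≡_ _≡_ (lookup t)
  inj′ eq = inj (trans (sym (v≗ _)) (trans eq (v≗ _)))
  adj′ : ∀ i → Adj X (lookup t (inject₁ i)) (lookup t (suc i))
  adj′ i = subst₂ (Adj X) (sym (v≗ _)) (sym (v≗ _)) (adj i)
  close′ : Adj X (lookup t (fromℕ (2 + m))) (lookup t zero)
  close′ = subst₂ (Adj X) (sym (v≗ _)) (sym (v≗ _)) close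
  sides⊆X : sides (lookup t) ⊆ X
  sides⊆X = sides-⊆ (lookup t) adj′ close′
  shrink : ∀ {P} → edgesOf P ⊆ sides (lookup t) → edgesOf P ⊆ X
  shrink P⊆ = ⊆-trans P⊆ sides⊆X

forest⇔ : IsForest X ⇔ (¬ ContainsPolygon X)
forest⇔ = mk⇔ (λ forest → forest ∘ polygon⇒cycle) (λ ∄P → ∄P ∘ cycle⇒polygon)

forest-down : DownClosed IsForest
forest-down X Y Y⊆X forestX (m , v , inj , adj , close) =
  forestX (m , v , inj , widen ∘ adj , widen close)
  where
  widen : ∀ {u w} → Adj Y u w → Adj X u w
  widen (e , e∈Y , e-joins) = e , Y⊆X e∈Y , e-joins

ClosedUnder : List Edges → Edges → Set
ClosedUnder Cs F = All (λ C → ∀ e → e ∈ C → C - e ⊆ F → e ∈ F) Cs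

Exchangeable : Edges → Fin 10 → Fin 10 → Set
Exchangeable K e z = ∃[ j ] (j ∈ K × ¬ IsForest (((K - j) ∪ ⁅ z ⁆) ∪ ⁅ e ⁆))

Linked : Edges → Fin 10 → Fin 10 → Set
Linked K e y = e ≡ y ⊎ Exchangeable K e y
  ⊎ ∃[ w ] (w ∉ K × IsForest (K ∪ ⁅ w ⁆) × Exchangeable K e w × Exchangeable K w y)

module Exhaustive (Ts Ps : List Edges) (Ts≡ : triangleEdges ≡ Ts) (Ps≡ : polygonEdges ≡ Ps) where

  open PolygonSearch Ts Ps Ts≡ Ps≡ public using (containsTriangle?; containsPolygon?)

  forest? : Decidable IsForest
  forest? X = Dec.map (⇔.sym forest⇔) (¬? (containsPolygon? X))

  open Closure forest? forest-down using (closure)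

  forest-size? : Dec (∀ X → IsForest X → ∣ X ∣ ≤ 4)
  forest-size? = all-subsets? λ X → forest? X →-dec ∣ X ∣ ≤? 4

  small-rank-bound? :
    Dec (∀ A → ∣ A ∣ ≤ 3 → IsForest A → ∀ I → I ⊆ closure A → IsForest I → ∣ I ∣ ≤ ∣ A ∣)
  small-rank-bound? = all-subsets? λ A → ∣ A ∣ ≤? 3 →-dec forest? A →-dec
    all-subsets-of? (closure A) λ I → forest? I →-dec ∣ I ∣ ≤? ∣ A ∣

  closedUnder? : ∀ Cs → Decidable (ClosedUnder Cs)
  closedUnder? Cs F = All.all? (λ C → all? λ e → e ∈? C →-dec C - e ⊆? F →-dec e ∈? F) Cs

  cycle-closure? : Dec (∀ F → ClosedUnder Ts F → ClosedUnder Ps F)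
  cycle-closure? = all-subsets? λ F → closedUnder? Ts F →-dec closedUnder? Ps F

  exchangeable? : ∀ K e z → Dec (Exchangeable K e z)
  exchangeable? K e z = any? λ j → j ∈? K ×-dec ¬? (forest? (((K - j) ∪ ⁅ z ⁆) ∪ ⁅ e ⁆))

  linked? : ∀ K e y → Dec (Linked K e y)
  linked? K e y = e Fin.≟ y ⊎-dec exchangeable? K e y ⊎-dec any? λ w →
    ¬? (w ∈? K) ×-dec forest? (K ∪ ⁅ w ⁆) ×-dec exchangeable? K e w ×-dec exchangeable? K w y

  spanning-tree-linked? : Dec (∀ Y → ∣ Y ∣ ≡ 4 → IsForest Y → ∃[ y ] (y ∈ Y ×
    ∀ e → e ∉ Y - y → IsForest ((Y - y) ∪ ⁅ e ⁆) → Linked (Y - y) e y))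
  spanning-tree-linked? = all-subsets? λ Y → ∣ Y ∣ ℕ.≟ 4 →-dec forest? Y →-dec any? λ y →
    y ∈? Y ×-dec all? λ e → ¬? (e ∈? (Y - y)) →-dec forest? ((Y - y) ∪ ⁅ e ⁆) →-dec linked? (Y - y) e y

open Exhaustive triangleEdges polygonEdges refl refl
open Closure forest? forest-down

-- T(D) and the cycle matroid of K₅

singleton-forest : ∀ e → IsForest ⁅ e ⁆
singleton-forest = from-yes (all? λ e → forest? ⁅ e ⁆)

empty-forest : IsForest ⊥
empty-forest = forest-down _ _ (⊆-min _) (singleton-forest zero)

forest-size : ∀ X → IsForest X → ∣ X ∣ ≤ 4
forest-size = from-yes forest-size?

small-forest-rank-bound :
  ∀ A → ∣ A ∣ ≤ 3 → IsForest A → ∀ I → I ⊆ closure A → IsForest I → ∣ I ∣ ≤ ∣ A ∣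
small-forest-rank-bound = from-yes small-rank-bound?

forest-rank-bound : RankBound
forest-rank-bound {A} {I} forestA forestI I⊆clA with ∣ A ∣ ≤? 3
... | yes ∣A∣≤3 = small-forest-rank-bound A ∣A∣≤3 forestA I I⊆clA forestI
... | no  ∣A∣≰3 = ≤-trans (forest-size I forestI) (≰⇒> ∣A∣≰3)

forest-matroid : IsMatroid IsForest
forest-matroid = rank-bound⇒matroid forest-rank-bound

triangle-closed⇒cycle-closed : ∀ F → ClosedUnder triangleEdges F → ClosedUnder polygonEdges F
triangle-closed⇒cycle-closed = from-yes cycle-closure?

cycle-closed⇒flat : ∀ {F} → ClosedUnder polygonEdges F → IsFlat IsForest F
cycle-closed⇒flat {F = F} closed A forestA A⊆F p p∉F = Equivalence.from forest⇔ λ P⊆A∪p →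
  Equivalence.to forest⇔ forestA (Any.map⁻ {f = edgesOf} {P = _⊆ A} {xs = polygons}
    (Any.map (λ {C} → avoid {C})
      (any-∩ closed (Any.map⁺ {f = edgesOf} {P = _⊆ A ∪ ⁅ p ⁆} {xs = polygons} P⊆A∪p))))
  where
  avoid : ∀ {C} → (∀ e → e ∈ C → C - e ⊆ F → e ∈ F) × C ⊆ A ∪ ⁅ p ⁆ → C ⊆ A
  avoid {C} (closedC , C⊆A∪p) {e} e∈C with e Fin.≟ p
  ... | no  e≢p  = x∈p∪⁅y⁆∧x≢y⇒x∈p (C⊆A∪p e∈C) e≢p
  ... | yes refl = contradiction (closedC e e∈C C-e⊆F) p∉F
    where
    C-e⊆F : C - e ⊆ F
    C-e⊆F x∈ = let x∈C , x≢e = x∈p-y⇒x∈p∧x≢y x∈ in A⊆F (x∈p∪⁅y⁆∧x≢y⇒x∈p (C⊆A∪p x∈C) x≢e)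

IsTriangleCircuit : Edges → Set
IsTriangleCircuit C = ¬ IsForest C × ∣ C ∣ ≡ 3 × ∀ e → e ∈ C → IsForest (C - e)

triangles-circuits : All (IsTriangleCircuit ∘ edgesOf) triangles
triangles-circuits = from-yes (All.all? (λ T → ¬? (forest? (edgesOf T)) ×-dec ∣ edgesOf T ∣ ℕ.≟ 3
  ×-dec all? λ e → e ∈? edgesOf T →-dec forest? (edgesOf T - e)) triangles)

T⇒triangle-closed : ∀ {F} → T 2 Desargues F → ClosedUnder triangleEdges F
T⇒triangle-closed {F = F} TF = All.map⁺ (All.map (λ {T} → closes (edgesOf T)) triangles-circuits)
  where
  closes : ∀ C → IsTriangleCircuit C → ∀ e → e ∈ C → C - e ⊆ F → e ∈ F
  closes C (cyclic , ∣C∣≡3 , forest-C-e) e e∈C C-e⊆F = decidable-stable (e ∈? F) λ e∉F →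
    cyclic (forest-down _ _ (p⊆p-x∪⁅x⁆ e)
      (proj₁ (TF (C - e) (forest-C-e e e∈C , ≤-trans ∣C-e∣≤2 (n≤1+n 2)) ∣C-e∣≤2 C-e⊆F e e∉F)))
    where
    ∣C-e∣≤2 : ∣ C - e ∣ ≤ 2
    ∣C-e∣≤2 = ≤-reflexive (suc-injective (trans (1+∣p-x∣≡∣p∣ e∈C) ∣C∣≡3))

T⇒flat : ∀ {F} → T 2 Desargues F → IsFlat IsForest F
T⇒flat = cycle-closed⇒flat ∘ triangle-closed⇒cycle-closed _ ∘ T⇒triangle-closed

J⇔forest : J (T 2 Desargues) X ⇔ IsForest X
J⇔forest {X = X} = mk⇔
  (transversal⇒independent forest-down empty-forest (λ _ → T⇒flat) X)
  (independent⇒transversal {R = T 2 Desargues} (λ _ → flat⇒T 2 ∘ closure-flat forest-matroid) X)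

star₀ : Edges
star₀ = select λ e → any? (joins? e zero)

star₀-spanning : IsForest star₀ × ∣ star₀ ∣ ≡ 4
star₀-spanning = from-yes (forest? star₀ ×-dec ∣ star₀ ∣ ℕ.≟ 4)

forests≈J : SameFamily IsForest (J (T 2 Desargues))
forests≈J X = ⇔.sym J⇔forest

J-complex : IsComplex (J (T 2 Desargues))
J-complex = complex-resp forests≈J (singleton-forest , forest-down)

J-matroid : IsMatroid (J (T 2 Desargues))
J-matroid = matroid-resp forests≈J forest-matroid

J-proper-extension : IsProperExtension 2 Desargues (J (T 2 Desargues))
J-proper-extension = (J-complex , agrees) , λ same →
  1+n≰n (subst (_≤ 3) (proj₂ star₀-spanning)
    (proj₂ (Equivalence.to (same star₀) (Equivalence.from J⇔forest (proj₁ star₀-spanning)))))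
  where
  agrees : ∀ X → ∣ X ∣ ≤ 3 → J (T 2 Desargues) X ⇔ Desargues X
  agrees X ∣X∣≤3 = ⇔.trans J⇔forest (mk⇔ (_, ∣X∣≤3) proj₁)

-- Proper matroid extensions of D

fan : Polygon → Edges
fan (_ , t) = select λ e → any? λ i → joins? e (lookup t zero) (lookup t (suc i))

BlockedByFan : Polygon → Set
BlockedByFan Q = ∣ edgesOf Q ∣ ≡ 4 × IsForest (fan Q) × ∣ fan Q ∣ ≡ 3
  × ∀ e → e ∈ edgesOf Q → e ∉ fan Q → ContainsTriangle (fan Q ∪ ⁅ e ⁆)

quadrilaterals-blocked : All BlockedByFan quadrilaterals
quadrilaterals-blocked = from-yes (All.all? (λ Q →
  ∣ edgesOf Q ∣ ℕ.≟ 4 ×-dec forest? (fan Q) ×-dec ∣ fan Q ∣ ℕ.≟ 3 ×-dec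
  all? λ e → e ∈? edgesOf Q →-dec ¬? (e ∈? fan Q) →-dec containsTriangle? (fan Q ∪ ⁅ e ⁆))
  quadrilaterals)

pentagon-size : All (λ P → ∣ edgesOf P ∣ ≡ 5) pentagons
pentagon-size = from-yes (All.all? (λ P → ∣ edgesOf P ∣ ℕ.≟ 5) pentagons)

star₀-maximal : ∀ e → e ∉ star₀ → ContainsTriangle (star₀ ∪ ⁅ e ⁆)
star₀-maximal = from-yes (all? λ e → ¬? (e ∈? star₀) →-dec containsTriangle? (star₀ ∪ ⁅ e ⁆))

spanning-tree-linked : ∀ Y → ∣ Y ∣ ≡ 4 → IsForest Y → ∃[ y ] (y ∈ Y ×
  ∀ e → e ∉ Y - y → IsForest ((Y - y) ∪ ⁅ e ⁆) → Linked (Y - y) e y)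
spanning-tree-linked = from-yes spanning-tree-linked?

module ProperMatroidExtension (h : Subset 10 → Bool) (matroid : IsMatroid (toFamily h))
  (proper : IsProperExtension 2 Desargues (toFamily h)) where

  H : Family 10
  H = toFamily h

  down : DownClosed H
  down = proj₂ (proj₁ (proj₁ proper))

  agrees : ∀ X → ∣ X ∣ ≤ 3 → H X ⇔ Desargues X
  agrees = proj₂ (proj₁ proper)

  small-forest : H X → ∣ X ∣ ≤ 3 → IsForest X
  small-forest HX ∣X∣≤3 = proj₁ (Equivalence.to (agrees _ ∣X∣≤3) HX)

  forest-small : IsForest X → ∣ X ∣ ≤ 3 → H X
  forest-small forestX ∣X∣≤3 = Equivalence.from (agrees _ ∣X∣≤3) (forestX , ∣X∣≤3)

  triangle-free : H X → ¬ ContainsTriangle X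
  triangle-free {X} HX T⊆X = dependent (edgesOf (Any.lookup T⊆X)) (All.lookupAny triangles-circuits T⊆X)
    where
    dependent : ∀ C → ¬ (IsTriangleCircuit C × C ⊆ X)
    dependent C ((cyclic , ∣C∣≡3 , _) , C⊆X) =
      cyclic (small-forest (down X C C⊆X HX) (≤-reflexive ∣C∣≡3))

  four-forest : H X → ∣ X ∣ ≡ 4 → IsForest X
  four-forest {X} HX ∣X∣≡4 = decidable-stable (forest? X) λ ¬forest →
    [ triangle-free HX
    , [ quadrilateral-free , pentagon-free ]′ ∘ Any.++⁻ quadrilaterals {ys = pentagons} ]′
      (Any.++⁻ triangles {ys = quadrilaterals ++ pentagons}
        (decidable-stable (containsPolygon? X) (¬forest ∘ Equivalence.from forest⇔)))
    where
    blocked-by-fan : ∀ {Q} → ¬ (BlockedByFan Q × edgesOf Q ⊆ X)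
    blocked-by-fan {Q} ((∣Q∣≡4 , forest-fan , ∣fan∣≡3 , blocked) , Q⊆X)
      with matroid (edgesOf Q) (fan Q) (down X (edgesOf Q) Q⊆X HX)
             (forest-small forest-fan (≤-reflexive ∣fan∣≡3)) (trans ∣Q∣≡4 (cong suc (sym ∣fan∣≡3)))
    ... | e , e∈Q , e∉fan , Hfan∪e = triangle-free Hfan∪e (blocked e e∈Q e∉fan)
    quadrilateral-free : ¬ Any (λ Q → edgesOf Q ⊆ X) quadrilaterals
    quadrilateral-free Q⊆X = blocked-by-fan {Any.lookup Q⊆X} (All.lookupAny quadrilaterals-blocked Q⊆X)
    too-big : ∀ {P} → ¬ (∣ edgesOf P ∣ ≡ 5 × edgesOf P ⊆ X)
    too-big (∣P∣≡5 , P⊆X) = 1+n≰n (subst₂ _≤_ ∣P∣≡5 ∣X∣≡4 (p⊆q⇒∣p∣≤∣q∣ P⊆X))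
    pentagon-free : ¬ Any (λ P → edgesOf P ⊆ X) pentagons
    pentagon-free P⊆X = too-big {Any.lookup P⊆X} (All.lookupAny pentagon-size P⊆X)

  has-basis : ∃[ B ] (H B × ∣ B ∣ ≡ 4)
  has-basis with anySubset? (λ X → (h X Bool.≟ true) ×-dec 4 ≤? ∣ X ∣)
  ... | yes (X , HX , 4≤∣X∣) =
    let B , B⊆X , ∣B∣≡4 = ⊆-of-size 4 X 4≤∣X∣ in B , down _ _ B⊆X HX , ∣B∣≡4
  ... | no  none = ⊥-elim (proj₂ proper same)
    where
    same : SameFamily H Desargues
    same X with ∣ X ∣ ≤? 3
    ... | yes ∣X∣≤3 = agrees X ∣X∣≤3
    ... | no  ∣X∣≰3 = mk⇔ (λ HX → ⊥-elim (none (X , HX , ≰⇒> ∣X∣≰3))) (⊥-elim ∘ ∣X∣≰3 ∘ proj₂)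

  -- Augmenting (K - j) ∪ ⁅ z ⁆ from K ∪ ⁅ e ⁆ can only add j, since adding e closes a cycle.
  exchange : ∀ {K e z} → ∣ K ∣ ≡ 3 → e ∉ K → z ∉ K → IsForest (K ∪ ⁅ z ⁆) →
    H (K ∪ ⁅ e ⁆) → Exchangeable K e z → H (K ∪ ⁅ z ⁆)
  exchange {K} {e} {z} ∣K∣≡3 e∉K z∉K forest-K∪z HK∪e (j , j∈K , cyclic) =
    swap-in (matroid (K ∪ ⁅ e ⁆) K′ HK∪e HK′ ∣K∪e∣≡1+∣K′∣)
    where
    K′ = (K - j) ∪ ⁅ z ⁆
    ∣K′∣≡3 : ∣ K′ ∣ ≡ 3
    ∣K′∣≡3 = trans (∣p∪⁅x⁆∣≡1+∣p∣ (z∉K ∘ proj₁ ∘ x∈p-y⇒x∈p∧x≢y)) (trans (1+∣p-x∣≡∣p∣ j∈K) ∣K∣≡3)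
    HK′ : H K′
    HK′ = forest-small (forest-down _ _ (∪-lub (p⊆p∪q _ ∘ p─q⊆p K _) (q⊆p∪q K _)) forest-K∪z)
            (≤-reflexive ∣K′∣≡3)
    ∣K∪e∣≡1+∣K′∣ : ∣ K ∪ ⁅ e ⁆ ∣ ≡ suc ∣ K′ ∣
    ∣K∪e∣≡1+∣K′∣ = trans (∣p∪⁅x⁆∣≡1+∣p∣ e∉K) (cong suc (trans ∣K∣≡3 (sym ∣K′∣≡3)))
    swap-in : ∃[ i ] (i ∈ K ∪ ⁅ e ⁆ × i ∉ K′ × H (K′ ∪ ⁅ i ⁆)) → H (K ∪ ⁅ z ⁆)
    swap-in (i , i∈K∪e , i∉K′ , HK′∪i) with i Fin.≟ e | i Fin.≟ j
    ... | yes refl | _        =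
      contradiction (four-forest HK′∪i (trans (∣p∪⁅x⁆∣≡1+∣p∣ i∉K′) (cong suc ∣K′∣≡3))) cyclic
    ... | no  i≢e  | no  i≢j  =
      contradiction (p⊆p∪q _ (x∈p∧x≢y⇒x∈p-y (x∈p∪⁅y⁆∧x≢y⇒x∈p i∈K∪e i≢e) i≢j)) i∉K′
    ... | no  _    | yes refl = down _ _ (∪-lub K⊆K′∪j (p⊆p∪q _ ∘ q⊆p∪q _ _)) HK′∪i
      where
      K⊆K′∪j : K ⊆ K′ ∪ ⁅ j ⁆
      K⊆K′∪j x∈K with x∈p∪q⁻ _ _ (p⊆p-x∪⁅x⁆ j x∈K)
      ... | inj₁ x∈K-j = p⊆p∪q _ (p⊆p∪q _ x∈K-j)
      ... | inj₂ x∈⁅j⁆ = q⊆p∪q _ _ x∈⁅j⁆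

  linked-step : ∀ {K e y} → ∣ K ∣ ≡ 3 → e ∉ K → y ∉ K → IsForest (K ∪ ⁅ y ⁆) →
    H (K ∪ ⁅ e ⁆) → Linked K e y → H (K ∪ ⁅ y ⁆)
  linked-step _ _ _ _ HK∪e (inj₁ refl) = HK∪e
  linked-step ∣K∣≡3 e∉K y∉K forest-K∪y HK∪e (inj₂ (inj₁ e⇄y)) =
    exchange ∣K∣≡3 e∉K y∉K forest-K∪y HK∪e e⇄y
  linked-step ∣K∣≡3 e∉K y∉K forest-K∪y HK∪e (inj₂ (inj₂ (w , w∉K , forest-K∪w , e⇄w , w⇄y))) =
    exchange ∣K∣≡3 w∉K y∉K forest-K∪y (exchange ∣K∣≡3 e∉K w∉K forest-K∪w HK∪e e⇄w) w⇄y

  spanning-tree : IsForest Y → ∣ Y ∣ ≡ 4 → H Y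
  spanning-tree {Y} forestY ∣Y∣≡4 = from-certificate (spanning-tree-linked Y ∣Y∣≡4 forestY) has-basis
    where
    from-certificate :
      ∃[ y ] (y ∈ Y × ∀ e → e ∉ Y - y → IsForest ((Y - y) ∪ ⁅ e ⁆) → Linked (Y - y) e y) →
      ∃[ B ] (H B × ∣ B ∣ ≡ 4) → H Y
    from-certificate (y , y∈Y , linked) (B₀ , HB₀ , ∣B₀∣≡4) =
      down _ _ (p⊆p-x∪⁅x⁆ y) (grow (matroid B₀ (Y - y) HB₀ HK (trans ∣B₀∣≡4 (cong suc (sym ∣K∣≡3)))))
      where
      ∣K∣≡3 : ∣ Y - y ∣ ≡ 3
      ∣K∣≡3 = suc-injective (trans (1+∣p-x∣≡∣p∣ y∈Y) ∣Y∣≡4)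
      HK : H (Y - y)
      HK = forest-small (forest-down _ _ (p─q⊆p Y _) forestY) (≤-reflexive ∣K∣≡3)
      grow : ∃[ e ] (e ∈ B₀ × e ∉ Y - y × H ((Y - y) ∪ ⁅ e ⁆)) → H ((Y - y) ∪ ⁅ y ⁆)
      grow (e , _ , e∉K , HK∪e) = linked-step ∣K∣≡3 e∉K (x∉p-x Y y)
        (forest-down _ _ (∪-lub (p─q⊆p Y _) (x∈p⇒⁅x⁆⊆p y∈Y)) forestY) HK∪e
        (linked e e∉K (four-forest HK∪e (trans (∣p∪⁅x⁆∣≡1+∣p∣ e∉K) (cong suc ∣K∣≡3))))

  at-most-four : H X → ∣ X ∣ ≤ 4
  at-most-four {X} HX with ∣ X ∣ ≤? 4
  ... | yes ∣X∣≤4 = ∣X∣≤4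
  ... | no  ∣X∣≰4 = ⊥-elim (triangle-free Hstar₀∪e (star₀-maximal e e∉star₀))
    where
    star₀-tree = proj₁ star₀-spanning
    ∣star₀∣≡4 = proj₂ star₀-spanning
    augmented = augment down matroid (spanning-tree star₀-tree ∣star₀∣≡4) HX
                  (subst (_< ∣ X ∣) (sym ∣star₀∣≡4) (≰⇒> ∣X∣≰4))
    e = proj₁ augmented
    e∉star₀ = proj₁ (proj₂ (proj₂ augmented))
    Hstar₀∪e = proj₂ (proj₂ (proj₂ augmented))

  H⇔forest : H X ⇔ IsForest X
  H⇔forest {X} = mk⇔ to from
    where
    to : H X → IsForest X
    to HX with ∣ X ∣ ≤? 3
    ... | yes ∣X∣≤3 = small-forest HX ∣X∣≤3
    ... | no  ∣X∣≰3 = four-forest HX (≤-antisym (at-most-four HX) (≰⇒> ∣X∣≰3))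
    from : IsForest X → H X
    from forestX with ∣ X ∣ ≤? 3
    ... | yes ∣X∣≤3 = forest-small forestX ∣X∣≤3
    ... | no  ∣X∣≰3 = spanning-tree forestX (≤-antisym (forest-size X forestX) (≰⇒> ∣X∣≰3))

theorem9p3 : (IsComplex (J (T 2 Desargues)) × IsMatroid (J (T 2 Desargues))
         × IsProperExtension 2 Desargues (J (T 2 Desargues)))
      × (∀ (h : Subset 10 → Bool) → IsMatroid (toFamily h)
           → IsProperExtension 2 Desargues (toFamily h)
           → SameFamily (toFamily h) (J (T 2 Desargues)))
theorem9p3 = (J-complex , J-matroid , J-proper-extension) ,
  λ h matroid proper X → ⇔.trans (ProperMatroidExtension.H⇔forest h matroid proper) (forests≈J X)
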